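{- Let $n\ge 3$ be an integer. Then $va_3^{\equiv}(K_{n,n,n})\leq 3\left\lfloor \frac{n+1}{4}\right\rfloor$.
   Context: All graphs are finite and simple. A $t$-coloring of a graph $G$ is a map $f:V(G)\to\{1,\dots,t\}$, with color classes $V_i=\{v: f(v)=i\}$. It is equitable if $\big||V_i|-|V_j|\big|\le 1$ for all $i,j$. A $(t,k)$-tree-coloring of $G$ is a $t$-coloring such that every connected component of each induced subgraph $G[V_i]$ is a tree of maximum degree at most $k$; an equitable $(t,k)$-tree-coloring is a $(t,k)$-tree-coloring that is equitable. The strong equitable vertex $k$-arboricity $va_k^{\equiv}(G)$ is the smallest integer $t$ such that $G$ has an equitable $(t',k)$-tree-coloring for every integer $t'\ge t$. $K_{n,n,n}$ denotes the complete tripartite graph whose three partite sets each have exactly $n$ vertices. -}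

module Defs where

open import Data.Nat using (ℕ; suc; _+_; _*_; _≤_)
open import Data.Fin using (Fin; quotient; _≟_)

open import Data.List using (List; []; _∷_; _++_; [_]; length; filter; allFin)
open import Data.List.Relation.Unary.All using (All)
open import Data.List.Relation.Unary.Unique.Propositional using (Unique)
open import Data.Product using (_×_; Σ; ∃)
open import Data.Unit using (⊤)
open import Data.Empty using (⊥)
open import Function.Definitions using (Injective)
open import Relation.Binary.PropositionalEquality using (_≡_; _≢_)
open import Relation.Nullary using (¬_)

record Graph : Set₁ where
  field
    N      : ℕ
    Adj    : Fin N → Fin N → Set
    sym    : ∀ {u v} → Adj u v → Adj v u
    irrefl : ∀ {v} → ¬ Adj v v
open Graph public

-- Complete tripartite graph K_{n,n,n}: vertex v ∈ Fin (3 * n) lies in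
-- part  quotient n v ∈ Fin 3 ; two vertices are adjacent iff their parts differ.
K3 : ℕ → Graph
K3 n = record
  { N      = 3 * n
  ; Adj    = λ u v → quotient {3} n u ≢ quotient {3} n v
  ; sym    = λ {u} {v} p q → p (Relation.Binary.PropositionalEquality.sym q)
  ; irrefl = λ {v} p → p (Relation.Binary.PropositionalEquality.refl {x = quotient {3} n v})
  }

Chain : {A : Set} → (A → A → Set) → List A → Set
Chain R []           = ⊤
Chain R (x ∷ [])     = ⊤
Chain R (x ∷ y ∷ xs) = R x y × Chain R (y ∷ xs)

module _ (G : Graph) where

  InClass : {t : ℕ} → (Fin (N G) → Fin t) → Fin t → Fin (N G) → Set
  InClass f i v = f v ≡ i

  -- a cycle of G[S]: distinct vertices x, y₁, …, y_l (l ≥ 2, so length ≥ 3),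
  -- all in S, with x y₁ … y_l x a closed walk in G
  HasCycleIn : (Fin (N G) → Set) → Set
  HasCycleIn S = Σ (Fin (N G)) λ x → Σ (List (Fin (N G))) λ ys →
    Unique (x ∷ ys) × (2 ≤ length ys) × All S (x ∷ ys) ×
    Chain (Adj G) (x ∷ ys ++ [ x ])

  -- every vertex of G[S] has degree at most k: no k+1 distinct neighbours in S
  MaxDegreeIn≤ : (Fin (N G) → Set) → ℕ → Set
  MaxDegreeIn≤ S k = ∀ v → S v → (g : Fin (suc k) → Fin (N G)) → Injective _≡_ _≡_ g →
    (∀ j → Adj G v (g j) × S (g j)) → ⊥

  -- (t,k)-tree-colouring: every component of every G[V_i] is a tree of max degree ≤ k,
  -- i.e. each G[V_i] is acyclic (a forest) and has maximum degree ≤ k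
  IsTreeColoring : (t k : ℕ) → (Fin (N G) → Fin t) → Set
  IsTreeColoring t k f = ∀ i → ¬ HasCycleIn (InClass f i) × MaxDegreeIn≤ (InClass f i) k

  classSize : {t : ℕ} → (Fin (N G) → Fin t) → Fin t → ℕ
  classSize f i = length (filter (λ v → f v ≟ i) (allFin (N G)))

  IsEquitable : (t : ℕ) → (Fin (N G) → Fin t) → Set
  IsEquitable t f = ∀ i j → classSize f i ≤ classSize f j + 1

  HasEquitableTreeColoring : (t k : ℕ) → Set
  HasEquitableTreeColoring t k = ∃ λ (f : Fin (N G) → Fin t) → IsTreeColoring t k f × IsEquitable t f

  -- t is admissible in the definition of va_k^≡(G):
  -- G has an equitable (t',k)-tree-colouring for every t' ≥ t.
  -- va_k^≡(G) ≤ T  holds iff  StronglyEquitable k T  (the set of admissible t is up-closed).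
  StronglyEquitable : (k t : ℕ) → Set
  StronglyEquitable k t = ∀ t' → t ≤ t' → HasEquitableTreeColoring t' k

-- Number the vertices of K_{n,n,n} part after part and let the colour classes be t consecutive
-- intervals cut at b i = ⌊(3n i + δ) / t⌋, so that their sizes differ by at most one.  An interval
-- inside one part is independent, and an interval meeting a part boundary induces a star of
-- maximum degree at most 3 when it has at most four vertices, only one of them on one side of the
-- boundary.  For t ≥ 3⌊(n+1)/4⌋ this is achieved by δ = 0 when t > n or 3 ∣ t, and by δ = n - t
-- when 2n < 3t; the only remaining case, n = 6 and t = 4, is coloured by hand.
module Submission where

open import Defs hiding (sym)
open import Data.Nat as ℕ
  using (ℕ; zero; suc; _+_; _*_; _∸_; _/_; _≤_; _<_; z≤n; s≤s; z<s; s<s; s≤s⁻¹; s<s⁻¹; NonZero)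
open import Data.Nat.Properties
open import Data.Nat.DivMod
open import Data.Nat.Divisibility using (_∣_; _∣?_; divides; ∣m+n∣m⇒∣n)
open import Data.Nat.Tactic.RingSolver using (solve-∀)
open import Data.Fin as Fin using (Fin; toℕ)
open import Data.Fin.Properties
  using (toℕ-injective; toℕ<n; toℕ-fromℕ<; injective⇒≤; toℕ-combine; combine-remQuot)
open import Data.List using ([]; _∷_; _++_; [_]; length; filter; tabulate)
open import Data.List.Properties using (filter-none; filter-accept; filter-reject)
open import Data.List.Relation.Unary.All as All using (All; []; _∷_)
open import Data.List.Relation.Unary.All.Properties using (tabulate⁺)
open import Data.List.Relation.Unary.AllPairs using (_∷_)
open import Data.Product using (Σ; _×_; _,_; proj₁; proj₂)
open import Data.Sum using (_⊎_; inj₁; inj₂)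
open import Data.Empty using (⊥; ⊥-elim)
open import Function.Base using (id; _∘_; case_of_)
open import Function.Definitions using (Injective)
open import Level using (0ℓ)
open import Relation.Nullary using (¬_; yes; no)
open import Relation.Unary using (Pred; _⊆_; Decidable)
open import Relation.Binary.Definitions using (tri<; tri≈; tri>)
open import Relation.Binary.PropositionalEquality
  using (_≡_; _≢_; refl; sym; trans; cong; subst; subst₂; module ≡-Reasoning)

module _ (G : Graph) where

  private
    V = Fin (N G)

  IsTreeClass : ℕ → Pred V _ → Set
  IsTreeClass k S = ¬ HasCycleIn G S × MaxDegreeIn≤ G S k

  DegreeIn≤ : Pred V _ → V → ℕ → Set
  DegreeIn≤ S v k = (g : Fin (suc k) → V) → Injective _≡_ _≡_ g →
    (∀ j → Adj G v (g j) × S (g j)) → ⊥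

  Independent : Pred V _ → Set
  Independent S = ∀ {u w} → S u → S w → ¬ Adj G u w

  StarCentredAt : Pred V _ → V → Set
  StarCentredAt S c = ∀ {u w} → S u → S w → Adj G u w → u ≡ c ⊎ w ≡ c

  isTreeClass-⊆ : ∀ {k} {S T : Pred V _} → S ⊆ T → IsTreeClass k T → IsTreeClass k S
  isTreeClass-⊆ S⊆T (acyclic , maxDegree) =
    (λ (x , ys , unique , long , inS , closed) → acyclic (x , ys , unique , long , All.map S⊆T inS , closed)) ,
    (λ v Sv g g-inj adj → maxDegree v (S⊆T Sv) g g-inj (λ j → proj₁ (adj j) , S⊆T (proj₂ (adj j))))

  independent⇒isTreeClass : ∀ {k} {S : Pred V _} → Independent S → IsTreeClass k S
  independent⇒isTreeClass indep =
    (λ { (x , y ∷ ys , _ , _ , Sx ∷ Sy ∷ _ , x~y , _) → indep Sx Sy x~y }) ,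
    (λ v Sv g _ adj → indep Sv (proj₂ (adj Fin.zero)) (proj₁ (adj Fin.zero)))

  module _ {S : Pred V _} {c : V} (star : StarCentredAt S c) where

    -- In a cycle x y₁ y₂ …, the edges x y₁ and y₁ y₂ both pass through c, which forces y₁ = c;
    -- then the edge leaving y₂ must return to c = y₁.
    star⇒acyclic : ¬ HasCycleIn G S
    star⇒acyclic (_ , [] , _ , () , _)
    star⇒acyclic (_ , _ ∷ [] , _ , s≤s () , _)
    star⇒acyclic (x , y₁ ∷ y₂ ∷ ys , (x≢y₁ ∷ x≢y₂ ∷ _) ∷ (y₁≢y₂ ∷ y₁∉ys) ∷ _ , _ ,
                  Sx ∷ Sy₁ ∷ Sy₂ ∷ Sys , x~y₁ , y₁~y₂ , path) = leaveY₂ ys y₁∉ys Sys path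
      where
      y₁≡c : y₁ ≡ c
      y₁≡c with star Sx Sy₁ x~y₁ | star Sy₁ Sy₂ y₁~y₂
      ... | inj₂ y₁≡c | _ = y₁≡c
      ... | _ | inj₁ y₁≡c = y₁≡c
      ... | inj₁ x≡c | inj₂ y₂≡c = ⊥-elim (x≢y₂ (trans x≡c (sym y₂≡c)))

      leaveY₂ : ∀ zs → All (y₁ ≢_) zs → All S zs → Chain (Adj G) (y₂ ∷ zs ++ [ x ]) → ⊥
      leaveY₂ [] _ _ (y₂~x , _) with star Sy₂ Sx y₂~x
      ... | inj₁ y₂≡c = y₁≢y₂ (trans y₁≡c (sym y₂≡c))
      ... | inj₂ x≡c = x≢y₁ (trans x≡c (sym y₁≡c))
      leaveY₂ (z ∷ _) (y₁≢z ∷ _) (Sz ∷ _) (y₂~z , _) with star Sy₂ Sz y₂~z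
      ... | inj₁ y₂≡c = y₁≢y₂ (trans y₁≡c (sym y₂≡c))
      ... | inj₂ z≡c = y₁≢z (trans y₁≡c (sym z≡c))

    star⇒maxDegree : ∀ {k} → (S c → DegreeIn≤ S c (suc k)) → MaxDegreeIn≤ G S (suc k)
    star⇒maxDegree centreDegree v Sv g g-inj adj with v Fin.≟ c
    ... | yes refl = centreDegree Sv g g-inj adj
    ... | no v≢c with g-inj (trans (towardsCentre Fin.zero) (sym (towardsCentre (Fin.suc Fin.zero))))
      where
      towardsCentre : ∀ j → g j ≡ c
      towardsCentre j with star Sv (proj₂ (adj j)) (proj₁ (adj j))
      ... | inj₁ v≡c = ⊥-elim (v≢c v≡c)
      ... | inj₂ gj≡c = gj≡c
    ... | ()

    star⇒isTreeClass : ∀ {k} → (S c → DegreeIn≤ S c (suc k)) → IsTreeClass (suc k) S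
    star⇒isTreeClass centreDegree = star⇒acyclic , star⇒maxDegree centreDegree

InInterval : ∀ {m} → ℕ → ℕ → Pred (Fin m) 0ℓ
InInterval lo hi v = lo ≤ toℕ v × toℕ v < hi

injective-into-interval⇒≤ : ∀ {m M lo l} (g : Fin m → Fin M) → Injective _≡_ _≡_ g →
  (∀ j → InInterval lo (lo + l) (g j)) → m ≤ l
injective-into-interval⇒≤ {lo = lo} {l} g g-inj inInterval = injective⇒≤ offset-injective
  where
  offset<l : ∀ j → toℕ (g j) ∸ lo < l
  offset<l j = let (lo≤gj , gj<lo+l) = inInterval j in
    subst (toℕ (g j) ∸ lo <_) (m+n∸m≡n lo l) (∸-monoˡ-< gj<lo+l lo≤gj)
  offset : Fin _ → Fin l
  offset j = Fin.fromℕ< (offset<l j)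
  offset-injective : Injective _≡_ _≡_ offset
  offset-injective {i} {j} eq = g-inj (toℕ-injective (∸-cancelʳ-≡ (proj₁ (inInterval i)) (proj₁ (inInterval j))
    (trans (sym (toℕ-fromℕ< (offset<l i))) (trans (cong toℕ eq) (toℕ-fromℕ< (offset<l j))))))

interval⇒degreeIn≤ : ∀ (G : Graph) {S : Pred (Fin (N G)) 0ℓ} {v lo k} →
  S ⊆ InInterval lo (lo + suc k) → S v → DegreeIn≤ G S v k
interval⇒degreeIn≤ G {S} {v} {lo} {k} S⊆I Sv g g-inj adj =
  <⇒≱ (n<1+n (suc k)) (injective-into-interval⇒≤ withV withV-injective (S⊆I ∘ S-withV))
  where
  withV : Fin (suc (suc k)) → Fin (N G)
  withV Fin.zero    = v
  withV (Fin.suc j) = g j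
  v≢g : ∀ j → v ≢ g j
  v≢g j v≡gj = irrefl G (subst (Adj G v) (sym v≡gj) (proj₁ (adj j)))
  withV-injective : Injective _≡_ _≡_ withV
  withV-injective {Fin.zero}  {Fin.zero}  _  = refl
  withV-injective {Fin.zero}  {Fin.suc j} eq = ⊥-elim (v≢g j eq)
  withV-injective {Fin.suc i} {Fin.zero}  eq = ⊥-elim (v≢g i (sym eq))
  withV-injective {Fin.suc i} {Fin.suc j} eq = cong Fin.suc (g-inj eq)
  S-withV : ∀ j → S (withV j)
  S-withV Fin.zero    = Sv
  S-withV (Fin.suc j) = proj₂ (adj j)

module _ {A : Set} {P : Pred A 0ℓ} (P? : Decidable P) where

  length-filter-tabulate-interval : ∀ {m} (h : Fin m → A) lo hi → hi ≤ m →
    (∀ k → P (h k) → InInterval lo hi k) → (∀ k → InInterval lo hi k → P (h k)) →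
    length (filter P? (tabulate h)) ≡ hi ∸ lo
  length-filter-tabulate-interval h lo zero _ sound _ =
    trans (cong length (filter-none P? (tabulate⁺ λ k Phk → n≮0 (proj₂ (sound k Phk))))) (sym (0∸n≡0 lo))
  length-filter-tabulate-interval {suc m} h zero (suc hi) (s≤s hi≤m) sound complete =
    trans (cong length (filter-accept P? (complete Fin.zero (z≤n , z<s)))) (cong suc rest)
    where
    rest : length (filter P? (tabulate (h ∘ Fin.suc))) ≡ hi
    rest = length-filter-tabulate-interval (h ∘ Fin.suc) 0 hi hi≤m
      (λ k Phk → z≤n , s<s⁻¹ (proj₂ (sound (Fin.suc k) Phk)))
      (λ k (_ , k<hi) → complete (Fin.suc k) (z≤n , s<s k<hi))
  length-filter-tabulate-interval {suc m} h (suc lo) (suc hi) (s≤s hi≤m) sound complete =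
    trans (cong length (filter-reject P? h0∉P)) rest
    where
    h0∉P : ¬ P (h Fin.zero)
    h0∉P Ph0 = case proj₁ (sound Fin.zero Ph0) of λ ()
    rest : length (filter P? (tabulate (h ∘ Fin.suc))) ≡ hi ∸ lo
    rest = length-filter-tabulate-interval (h ∘ Fin.suc) lo hi hi≤m
      (λ k Phk → let (lo≤k , k<hi) = sound (Fin.suc k) Phk in s≤s⁻¹ lo≤k , s<s⁻¹ k<hi)
      (λ k (lo≤k , k<hi) → complete (Fin.suc k) (s≤s lo≤k , s<s k<hi))

module IntervalColouring (G : Graph) {t : ℕ} (b : ℕ → ℕ)
  (b-mono : ∀ i → b i ≤ b (suc i)) (b-zero : b 0 ≡ 0) (b-last : b t ≡ N G) where

  Slot : ℕ → Pred (Fin (N G)) 0ℓ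
  Slot i = InInterval (b i) (b (suc i))

  b-mono-≤ : ∀ {i k} → i ≤ k → b i ≤ b k
  b-mono-≤ i≤k = go (≤⇒≤′ i≤k)
    where
    go : ∀ {i k} → i ℕ.≤′ k → b i ≤ b k
    go ℕ.≤′-refl     = ≤-refl
    go (ℕ.≤′-step p) = ≤-trans (go p) (b-mono _)

  findSlot : ∀ {T} j → j < b T → Σ ℕ λ i → i < T × b i ≤ j × j < b (suc i)
  findSlot {zero} j j<b0 = ⊥-elim (n≮0 (subst (j <_) b-zero j<b0))
  findSlot {suc T} j j<bT+1 with b T ≤? j
  ... | yes bT≤j = T , n<1+n T , bT≤j , j<bT+1
  ... | no bT≰j  = let (i , i<T , bi≤j , j<bi+1) = findSlot j (≰⇒> bT≰j) in i , m<n⇒m<1+n i<T , bi≤j , j<bi+1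

  slot-unique : ∀ {i k j} → b i ≤ j → j < b (suc i) → b k ≤ j → j < b (suc k) → i ≡ k
  slot-unique {i} {k} bi≤j j<bi+1 bk≤j j<bk+1 with <-cmp i k
  ... | tri< i<k _ _ = ⊥-elim (<⇒≱ j<bi+1 (≤-trans (b-mono-≤ i<k) bk≤j))
  ... | tri≈ _ i≡k _ = i≡k
  ... | tri> _ _ k<i = ⊥-elim (<⇒≱ j<bk+1 (≤-trans (b-mono-≤ k<i) bi≤j))

  slotOf : (v : Fin (N G)) → Σ ℕ λ i → i < t × b i ≤ toℕ v × toℕ v < b (suc i)
  slotOf v = findSlot (toℕ v) (subst (toℕ v <_) (sym b-last) (toℕ<n v))

  colour : Fin (N G) → Fin t
  colour v = Fin.fromℕ< (proj₁ (proj₂ (slotOf v)))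

  colour⇒slot : ∀ {v i} → colour v ≡ i → Slot (toℕ i) v
  colour⇒slot {v} refl rewrite toℕ-fromℕ< (proj₁ (proj₂ (slotOf v))) = proj₂ (proj₂ (slotOf v))

  slot⇒colour : ∀ {v i} → Slot (toℕ i) v → colour v ≡ i
  slot⇒colour {v} {i} (bi≤v , v<bi+1) =
    let (_ , i′<t , bi′≤v , v<bi′+1) = slotOf v in
    toℕ-injective (trans (toℕ-fromℕ< i′<t) (slot-unique bi′≤v v<bi′+1 bi≤v v<bi+1))

  classSize-colour : ∀ i → classSize G colour i ≡ b (suc (toℕ i)) ∸ b (toℕ i)
  classSize-colour i = length-filter-tabulate-interval (λ v → colour v Fin.≟ i) id (b (toℕ i)) (b (suc (toℕ i)))
    (subst (b (suc (toℕ i)) ≤_) b-last (b-mono-≤ (toℕ<n i)))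
    (λ _ → colour⇒slot) (λ _ → slot⇒colour)

  intervalColouring : ∀ {k} size → (∀ i → i < t → size ≤ b (suc i) ∸ b i × b (suc i) ∸ b i ≤ size + 1) →
    (∀ i → i < t → IsTreeClass G k (Slot i)) → HasEquitableTreeColoring G t k
  intervalColouring {k} size balanced treeSlot = colour , isTree , isEquitable
    where
    isTree : IsTreeColoring G t k colour
    isTree i = isTreeClass-⊆ G colour⇒slot (treeSlot (toℕ i) (toℕ<n i))
    isEquitable : IsEquitable G t colour
    isEquitable i j rewrite classSize-colour i | classSize-colour j =
      ≤-trans (proj₂ (balanced (toℕ i) (toℕ<n i))) (+-monoˡ-≤ 1 (proj₁ (balanced (toℕ j) (toℕ<n j))))

module _ {t : ℕ} .{{_ : NonZero t}} where

  m*n≤o⇒m≤o/n : ∀ {a x} → a * t ≤ x → a ≤ x / t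
  m*n≤o⇒m≤o/n {a} {x} at≤x = subst (_≤ x / t) (m*n/n≡m a t) (/-monoˡ-≤ t at≤x)

  m≤o/n⇒m*n≤o : ∀ {a x} → a ≤ x / t → a * t ≤ x
  m≤o/n⇒m*n≤o {a} {x} a≤x/t = ≤-trans (*-monoˡ-≤ t a≤x/t) (m/n*n≤m x t)

  m/n<o⇒m<o*n : ∀ {a x} → x / t < a → x < a * t
  m/n<o⇒m<o*n x/t<a = ≰⇒> (λ at≤x → <⇒≱ x/t<a (m*n≤o⇒m≤o/n at≤x))

  m<[1+m/n]*n : ∀ x → x < suc (x / t) * t
  m<[1+m/n]*n x = m/n<o⇒m<o*n (n<1+n (x / t))

  m/n≡o : ∀ {a x} → a * t ≤ x → x < suc a * t → x / t ≡ a
  m/n≡o at≤x x<[a+1]t = ≤-antisym (s≤s⁻¹ (m<n*o⇒m/o<n x<[a+1]t)) (m*n≤o⇒m≤o/n at≤x)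

  [m+kn]/n≡m/n+k : ∀ x k → (x + k * t) / t ≡ x / t + k
  [m+kn]/n≡m/n+k x k = m/n≡o
    (subst (_≤ x + k * t) (sym (*-distribʳ-+ t (x / t) k)) (+-monoˡ-≤ (k * t) (m/n*n≤m x t)))
    (subst (x + k * t <_) (sym (*-distribʳ-+ t (suc (x / t)) k)) (+-monoˡ-< (k * t) (m<[1+m/n]*n x)))

  m/n+o/n≤[m+o]/n : ∀ x y → x / t + y / t ≤ (x + y) / t
  m/n+o/n≤[m+o]/n x y = m*n≤o⇒m≤o/n (subst (_≤ x + y) (sym (*-distribʳ-+ t (x / t) (y / t)))
    (+-mono-≤ (m/n*n≤m x t) (m/n*n≤m y t)))

  [m+o]/n≤m/n+o/n+1 : ∀ x y → (x + y) / t ≤ x / t + y / t + 1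
  [m+o]/n≤m/n+o/n+1 x y = s≤s⁻¹ (m<n*o⇒m/o<n (begin-strict
      x + y                             <⟨ +-mono-< (m<[1+m/n]*n x) (m<[1+m/n]*n y) ⟩
      suc (x / t) * t + suc (y / t) * t ≡⟨ regroup (x / t) (y / t) t ⟩
      suc (x / t + y / t + 1) * t       ∎))
    where
    open ≤-Reasoning
    regroup : ∀ a b t → suc a * t + suc b * t ≡ suc (a + b + 1) * t
    regroup = solve-∀

module FloorBreakpoints (N t δ : ℕ) .{{_ : NonZero t}} (δ<t : δ < t) where

  b : ℕ → ℕ
  b i = (N * i + δ) / t

  N[1+i]+δ≡[Ni+δ]+N : ∀ i → N * suc i + δ ≡ (N * i + δ) + N
  N[1+i]+δ≡[Ni+δ]+N i = shift N i δ
    where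
    shift : ∀ N i δ → N * suc i + δ ≡ (N * i + δ) + N
    shift = solve-∀

  b-mono-≤ : ∀ {i k} → i ≤ k → b i ≤ b k
  b-mono-≤ i≤k = /-monoˡ-≤ t (+-monoˡ-≤ δ (*-monoʳ-≤ N i≤k))

  b-mono : ∀ i → b i ≤ b (suc i)
  b-mono i = b-mono-≤ (n≤1+n i)

  b-zero : b 0 ≡ 0
  b-zero = trans (cong (λ z → (z + δ) / t) (*-zeroʳ N)) (m<n⇒m/n≡0 δ<t)

  b-last : b t ≡ N
  b-last = m/n≡o (m≤m+n (N * t) δ) (subst (N * t + δ <_) (+-comm (N * t) t) (+-monoʳ-< (N * t) δ<t))

  b-suc-bounds : ∀ i → b i + N / t ≤ b (suc i) × b (suc i) ≤ b i + N / t + 1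
  b-suc-bounds i rewrite N[1+i]+δ≡[Ni+δ]+N i =
    m/n+o/n≤[m+o]/n (N * i + δ) N , [m+o]/n≤m/n+o/n+1 (N * i + δ) N

  b-balanced : ∀ i → N / t ≤ b (suc i) ∸ b i × b (suc i) ∸ b i ≤ N / t + 1
  b-balanced i = let (lower , upper) = b-suc-bounds i in
    subst (_≤ b (suc i) ∸ b i) (m+n∸m≡n (b i) (N / t)) (∸-monoˡ-≤ (b i) lower) ,
    m≤n+o⇒m∸n≤o (b (suc i)) (b i) (subst (b (suc i) ≤_) (+-assoc (b i) (N / t) 1) upper)

2n<3t⇒n<2t : ∀ {n t} → 2 * n < 3 * t → n < 2 * t
2n<3t⇒n<2t {n} {t} 2n<3t = *-cancelˡ-< 2 n (2 * t) (begin-strict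
  2 * n       <⟨ 2n<3t ⟩
  3 * t       ≤⟨ *-monoˡ-≤ t (n≤1+n 3) ⟩
  4 * t       ≡⟨ *-assoc 2 2 t ⟩
  2 * (2 * t) ∎)
  where open ≤-Reasoning

2n<3t⇒3n<5t : ∀ {n t} → 2 * n < 3 * t → 3 * n < 5 * t
2n<3t⇒3n<5t {n} {t} 2n<3t = *-cancelˡ-< 2 (3 * n) (5 * t) (begin-strict
  2 * (3 * n) ≡⟨ trans (sym (*-assoc 3 2 n)) (*-assoc 2 3 n) ⟨
  3 * (2 * n) <⟨ *-monoʳ-< 3 2n<3t ⟩
  3 * (3 * t) ≡⟨ *-assoc 3 3 t ⟨
  9 * t       ≤⟨ *-monoˡ-≤ t (n≤1+n 9) ⟩
  10 * t      ≡⟨ *-assoc 2 5 t ⟩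
  2 * (5 * t) ∎)
  where open ≤-Reasoning

toℕ-quotient : ∀ {m} n .{{_ : NonZero n}} (v : Fin (m * n)) → toℕ (Fin.quotient {m} n v) ≡ toℕ v / n
toℕ-quotient {m} n v = sym (begin
  toℕ v / n             ≡⟨ cong (λ w → toℕ w / n) (combine-remQuot {m} n v) ⟨
  toℕ (Fin.combine q r) / n ≡⟨ cong (_/ n) (trans (toℕ-combine q r) (+-comm (n * toℕ q) (toℕ r))) ⟩
  (toℕ r + n * toℕ q) / n   ≡⟨ cong (λ z → (toℕ r + z) / n) (*-comm n (toℕ q)) ⟩
  (toℕ r + toℕ q * n) / n   ≡⟨ [m+kn]/n≡m/n+k (toℕ r) (toℕ q) ⟩
  toℕ r / n + toℕ q         ≡⟨ cong (_+ toℕ q) (m<n⇒m/n≡0 (toℕ<n r)) ⟩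
  toℕ q                     ∎)
  where
  open ≡-Reasoning
  q = Fin.quotient {m} n v
  r = Fin.remainder {m} n v

-- [lo, hi) has a single vertex on one side of the part boundary B and at most four in all,
-- so it induces a star in K_{n,n,n} centred at that vertex.
CrossesAsStar : ℕ → ℕ → ℕ → Set
CrossesAsStar lo hi B = (suc lo ≡ B × hi ≤ B + 3) ⊎ (hi ≡ suc B × B ≤ lo + 3)

short⇒crossesAsStar : ∀ {lo hi B} → lo < B → B < hi → hi ≤ lo + 3 → CrossesAsStar lo hi B
short⇒crossesAsStar {lo} {hi} {B} lo<B B<hi hi≤lo+3 with suc lo ℕ.≟ B
... | yes lo+1≡B = inj₁ (lo+1≡B , ≤-trans hi≤lo+3 (+-monoˡ-≤ 3 (<⇒≤ lo<B)))
... | no lo+1≢B = inj₂ (≤-antisym hi≤B+1 B<hi , ≤-trans (<⇒≤ B<hi) hi≤lo+3)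
  where
  hi≤B+1 : hi ≤ suc B
  hi≤B+1 = ≤-trans hi≤lo+3 (subst (_≤ suc B) (+-comm 3 lo) (s≤s (≤∧≢⇒< lo<B lo+1≢B)))

module _ {t : ℕ} .{{_ : NonZero t}} where

  floor-crossesAsStar : ∀ {n x B} → 2 * n < 3 * t → B < (x + 3 * n) / t →
    x + t ≡ B * t ⊎ x + (n + t) ≡ B * t → CrossesAsStar (x / t) ((x + 3 * n) / t) B
  floor-crossesAsStar {n} {x} {B} 2n<3t _ (inj₁ x+t≡Bt) = inj₁ (lo+1≡B , hi≤B+3)
    where
    open ≤-Reasoning
    lo+1≡B : suc (x / t) ≡ B
    lo+1≡B = begin-equality
      suc (x / t)       ≡⟨ +-comm 1 (x / t) ⟩
      x / t + 1         ≡⟨ [m+kn]/n≡m/n+k x 1 ⟨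
      (x + 1 * t) / t   ≡⟨ cong (λ z → (x + z) / t) (*-identityˡ t) ⟩
      (x + t) / t       ≡⟨ cong (_/ t) x+t≡Bt ⟩
      B * t / t         ≡⟨ m*n/n≡m B t ⟩
      B                 ∎
    x+3n<[B+4]t : x + 3 * n < (B + 4) * t
    x+3n<[B+4]t = begin-strict
      x + 3 * n   <⟨ +-monoʳ-< x (2n<3t⇒3n<5t {n} {t} 2n<3t) ⟩
      x + 5 * t   ≡⟨ regroup x t ⟩
      (x + t) + 4 * t ≡⟨ cong (_+ 4 * t) x+t≡Bt ⟩
      B * t + 4 * t   ≡⟨ *-distribʳ-+ t B 4 ⟨
      (B + 4) * t ∎
      where
      regroup : ∀ x t → x + 5 * t ≡ (x + t) + 4 * t
      regroup = solve-∀
    hi≤B+3 : (x + 3 * n) / t ≤ B + 3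
    hi≤B+3 = s≤s⁻¹ (subst ((x + 3 * n) / t <_) (+-suc B 3) (m<n*o⇒m/o<n x+3n<[B+4]t))
  floor-crossesAsStar {n} {x} {B} 2n<3t B<hi (inj₂ x+[n+t]≡Bt) = inj₂ (hi≡B+1 , B≤lo+3)
    where
    open ≤-Reasoning
    x+3n<[B+2]t : x + 3 * n < (B + 2) * t
    x+3n<[B+2]t = begin-strict
      x + 3 * n           ≡⟨ regroup₁ x n ⟩
      (x + n) + 2 * n     <⟨ +-monoʳ-< (x + n) 2n<3t ⟩
      (x + n) + 3 * t     ≡⟨ regroup₂ x n t ⟩
      x + (n + t) + 2 * t ≡⟨ cong (_+ 2 * t) x+[n+t]≡Bt ⟩
      B * t + 2 * t       ≡⟨ *-distribʳ-+ t B 2 ⟨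
      (B + 2) * t         ∎
      where
      regroup₁ : ∀ x n → x + 3 * n ≡ (x + n) + 2 * n
      regroup₁ = solve-∀
      regroup₂ : ∀ x n t → (x + n) + 3 * t ≡ x + (n + t) + 2 * t
      regroup₂ = solve-∀
    hi≡B+1 : (x + 3 * n) / t ≡ suc B
    hi≡B+1 = ≤-antisym (s≤s⁻¹ (subst ((x + 3 * n) / t <_) (+-comm B 2) (m<n*o⇒m/o<n x+3n<[B+2]t))) B<hi
    Bt≤x+3t : B * t ≤ x + 3 * t
    Bt≤x+3t = begin
      B * t       ≡⟨ x+[n+t]≡Bt ⟨
      x + (n + t) ≤⟨ +-monoʳ-≤ x (+-monoˡ-≤ t (<⇒≤ (2n<3t⇒n<2t {n} {t} 2n<3t))) ⟩
      x + (2 * t + t) ≡⟨ cong (x +_) (+-comm (2 * t) t) ⟩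
      x + 3 * t   ∎
    B≤lo+3 : B ≤ x / t + 3
    B≤lo+3 = subst (B ≤_) ([m+kn]/n≡m/n+k x 3) (m*n≤o⇒m≤o/n Bt≤x+3t)

module K3Intervals (n : ℕ) (3≤n : 3 ≤ n) where

  instance
    n-nonZero : NonZero n
    n-nonZero = ℕ.>-nonZero (≤-trans (s≤s z≤n) 3≤n)

  InPart : ℕ → ℕ → Set
  InPart q j = q * n ≤ j × j < suc q * n

  inSamePart⇒¬Adj : ∀ {q} {u w : Fin (3 * n)} → InPart q (toℕ u) → InPart q (toℕ w) → ¬ Adj (K3 n) u w
  inSamePart⇒¬Adj {q} {u} {w} (qn≤u , u<[q+1]n) (qn≤w , w<[q+1]n) u~w = u~w (toℕ-injective (begin
    toℕ (Fin.quotient n u) ≡⟨ toℕ-quotient n u ⟩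
    toℕ u / n              ≡⟨ m/n≡o qn≤u u<[q+1]n ⟩
    q                      ≡⟨ m/n≡o qn≤w w<[q+1]n ⟨
    toℕ w / n              ≡⟨ toℕ-quotient n w ⟨
    toℕ (Fin.quotient n w) ∎))
    where open ≡-Reasoning

  inPart⇒isTreeClass : ∀ {k q lo hi} → q * n ≤ lo → hi ≤ suc q * n →
    IsTreeClass (K3 n) k (InInterval lo hi)
  inPart⇒isTreeClass {q = q} {lo} {hi} qn≤lo hi≤[q+1]n =
    independent⇒isTreeClass (K3 n) λ Iu Iw → inSamePart⇒¬Adj {q} (inPart Iu) (inPart Iw)
    where
    inPart : ∀ {v : Fin (3 * n)} → InInterval lo hi v → InPart q (toℕ v)
    inPart (lo≤v , v<hi) = ≤-trans qn≤lo lo≤v , <-≤-trans v<hi hi≤[q+1]n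

  starInterval⇒isTreeClass : ∀ {q lo hi c} → hi ≤ lo + 4 → c < 3 * n →
    (∀ j → lo ≤ j → j < hi → j ≢ c → InPart q j) → IsTreeClass (K3 n) 3 (InInterval lo hi)
  starInterval⇒isTreeClass {q} {lo} {hi} {c} hi≤lo+4 c<3n inPartUnlessC =
    star⇒isTreeClass (K3 n) throughCentre (interval⇒degreeIn≤ (K3 n) {InInterval lo hi} shorten)
    where
    shorten : InInterval lo hi ⊆ InInterval lo (lo + 4)
    shorten (lo≤v , v<hi) = lo≤v , <-≤-trans v<hi hi≤lo+4
    centre : Fin (3 * n)
    centre = Fin.fromℕ< c<3n
    throughCentre : StarCentredAt (K3 n) (InInterval lo hi) centre
    throughCentre {u} {w} (lo≤u , u<hi) (lo≤w , w<hi) u~w with toℕ u ℕ.≟ c | toℕ w ℕ.≟ c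
    ... | yes u≡c | _ = inj₁ (toℕ-injective (trans u≡c (sym (toℕ-fromℕ< c<3n))))
    ... | no _ | yes w≡c = inj₂ (toℕ-injective (trans w≡c (sym (toℕ-fromℕ< c<3n))))
    ... | no u≢c | no w≢c =
      ⊥-elim (inSamePart⇒¬Adj {q} (inPartUnlessC _ lo≤u u<hi u≢c) (inPartUnlessC _ lo≤w w<hi w≢c) u~w)

  crossesAsStar⇒isTreeClass : ∀ {lo hi} → hi ≤ 3 * n →
    (∀ p → 0 < p → p < 3 → lo < p * n → p * n < hi → CrossesAsStar lo hi (p * n)) →
    IsTreeClass (K3 n) 3 (InInterval lo hi)
  crossesAsStar⇒isTreeClass {lo} {hi} hi≤3n crossings with hi ≤? suc (lo / n) * n
  ... | yes hi≤B = inPart⇒isTreeClass {q = lo / n} (m/n*n≤m lo n) hi≤B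
  ... | no hi≰B = fromCrossing (crossings (suc q) z<s q+1<3 lo<B B<hi)
    where
    q = lo / n
    B = suc q * n
    lo<B : lo < B
    lo<B = m<[1+m/n]*n lo
    B<hi : B < hi
    B<hi = ≰⇒> hi≰B
    q+1<3 : suc q < 3
    q+1<3 = *-cancelʳ-< n (suc q) 3 (<-≤-trans B<hi hi≤3n)
    fromCrossing : CrossesAsStar lo hi B → IsTreeClass (K3 n) 3 (InInterval lo hi)
    fromCrossing (inj₁ (lo+1≡B , hi≤B+3)) = starInterval⇒isTreeClass {suc q} {c = lo}
      (≤-trans hi≤B+3 (≤-reflexive (trans (cong (_+ 3) (sym lo+1≡B)) (sym (+-suc lo 3)))))
      (<-≤-trans (<-trans lo<B B<hi) hi≤3n)
      (λ j lo≤j j<hi j≢lo → subst (_≤ j) lo+1≡B (≤∧≢⇒< lo≤j (j≢lo ∘ sym)) ,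
                            <-≤-trans j<hi (≤-trans hi≤B+3 (subst (B + 3 ≤_) (+-comm B n) (+-monoʳ-≤ B 3≤n))))
    fromCrossing (inj₂ (hi≡B+1 , B≤lo+3)) = starInterval⇒isTreeClass {q} {c = B}
      (subst (_≤ lo + 4) (sym hi≡B+1) (subst (suc B ≤_) (sym (+-suc lo 3)) (s≤s B≤lo+3)))
      (<-≤-trans B<hi hi≤3n)
      (λ j lo≤j j<hi j≢B → ≤-trans (m/n*n≤m lo n) lo≤j , ≤∧≢⇒< (s≤s⁻¹ (subst (j <_) hi≡B+1 j<hi)) j≢B)

module K3FloorColouring (n : ℕ) (3≤n : 3 ≤ n) (t δ : ℕ) .{{_ : NonZero t}} (δ<t : δ < t) where
  open FloorBreakpoints (3 * n) t δ δ<t public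
  open K3Intervals n 3≤n

  floorColouring :
    (∀ i → i < t → ∀ p → 0 < p → p < 3 → b i < p * n → p * n < b (suc i) →
      CrossesAsStar (b i) (b (suc i)) (p * n)) →
    HasEquitableTreeColoring (K3 n) t 3
  floorColouring crossings = IntervalColouring.intervalColouring (K3 n) b b-mono b-zero b-last
    ((3 * n) / t) (λ i _ → b-balanced i)
    (λ i i<t → crossesAsStar⇒isTreeClass (subst (b (suc i) ≤_) b-last (b-mono-≤ i<t)) (crossings i i<t))

-- Every class has at most three vertices.
manyColours-colouring : ∀ {n t} → 3 ≤ n → n < t → HasEquitableTreeColoring (K3 n) t 3
manyColours-colouring {n} {t} 3≤n n<t = floorColouring λ i _ p _ _ lo<B B<hi →
  short⇒crossesAsStar lo<B B<hi (begin
    b (suc i)               ≤⟨ proj₂ (b-suc-bounds i) ⟩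
    b i + (3 * n) / t + 1   ≤⟨ +-monoˡ-≤ 1 (+-monoʳ-≤ (b i) 3n/t≤2) ⟩
    b i + 2 + 1             ≡⟨ +-assoc (b i) 2 1 ⟩
    b i + 3                 ∎)
  where
  instance
    t-nonZero : NonZero t
    t-nonZero = ℕ.>-nonZero (<-trans (≤-trans (s≤s z≤n) 3≤n) n<t)
  open K3FloorColouring n 3≤n t 0 (ℕ.>-nonZero⁻¹ t)
  open ≤-Reasoning
  3n/t≤2 : (3 * n) / t ≤ 2
  3n/t≤2 = s≤s⁻¹ (m<n*o⇒m/o<n (*-monoʳ-< 3 n<t))

-- The breakpoints b (p t/3) fall exactly on the part boundaries p n.
divisibleColours-colouring : ∀ {n t} .{{_ : NonZero t}} → 3 ≤ n → 3 ∣ t → HasEquitableTreeColoring (K3 n) t 3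
divisibleColours-colouring {n} {t} 3≤n (divides a t≡a*3) =
  floorColouring λ i _ p _ _ lo<B B<hi → ⊥-elim (noBoundaryInside i p lo<B B<hi)
  where
  open K3FloorColouring n 3≤n t 0 (ℕ.>-nonZero⁻¹ t)
  b[pa]≡pn : ∀ p → b (p * a) ≡ p * n
  b[pa]≡pn p = begin
    (3 * n * (p * a) + 0) / t ≡⟨ cong (_/ t) (regroup n p a) ⟩
    (p * n) * (a * 3) / t     ≡⟨ cong (λ z → p * n * z / t) t≡a*3 ⟨
    (p * n) * t / t           ≡⟨ m*n/n≡m (p * n) t ⟩
    p * n                     ∎
    where
    open ≡-Reasoning
    regroup : ∀ n p a → 3 * n * (p * a) + 0 ≡ p * n * (a * 3)
    regroup = solve-∀
  noBoundaryInside : ∀ i p → b i < p * n → p * n < b (suc i) → ⊥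
  noBoundaryInside i p lo<pn pn<hi with i <? p * a
  ... | yes i<pa = <⇒≱ pn<hi (subst (b (suc i) ≤_) (b[pa]≡pn p) (b-mono-≤ i<pa))
  ... | no i≮pa  = <⇒≱ lo<pn (subst (_≤ b i) (b[pa]≡pn p) (b-mono-≤ (≮⇒≥ i≮pa)))

3∣pt⇒3∣t : ∀ {p t} → 0 < p → p < 3 → 3 ∣ p * t → 3 ∣ t
3∣pt⇒3∣t {1} {t} _ _ 3∣t = subst (3 ∣_) (+-identityʳ t) 3∣t
3∣pt⇒3∣t {2} {t} _ _ 3∣2t = ∣m+n∣m⇒∣n 3∣2t+t 3∣2t
  where
  3∣2t+t : 3 ∣ 2 * t + t
  3∣2t+t = divides t (trans (+-comm (2 * t) t) (*-comm 3 t))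
3∣pt⇒3∣t {suc (suc (suc _))} _ (s≤s (s≤s (s≤s ())))

P≡K⊎P≡1+K : ∀ {n t K P} → t ≤ n → n * K < n * P + t → n * P < n * (3 + K) → P ≢ 2 + K → P ≡ K ⊎ P ≡ suc K
P≡K⊎P≡1+K {n} {t} {K} {P} t≤n nK<nP+t nP<n[3+K] P≢2+K = fromBounds (m≤n⇒m<n∨m≡n K≤P)
  where
  K≤P : K ≤ P
  K≤P = ≮⇒≥ λ P<K → <⇒≱ nK<nP+t (begin
    n * P + t   ≤⟨ +-monoʳ-≤ (n * P) t≤n ⟩
    n * P + n   ≡⟨ trans (+-comm (n * P) n) (sym (*-suc n P)) ⟩
    n * suc P   ≤⟨ *-monoʳ-≤ n P<K ⟩
    n * K       ∎)
    where open ≤-Reasoning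
  P<2+K : P < 2 + K
  P<2+K = ≤∧≢⇒< (s≤s⁻¹ (*-cancelˡ-< n P (3 + K) nP<n[3+K])) P≢2+K
  fromBounds : K < P ⊎ K ≡ P → P ≡ K ⊎ P ≡ suc K
  fromBounds (inj₁ K<P) = inj₂ (≤-antisym (s≤s⁻¹ P<2+K) K<P)
  fromBounds (inj₂ K≡P) = inj₁ (sym K≡P)

-- With δ = n - t the numerator x of b i satisfies x + t = n (3i + 1); as 3 ∤ t, a part
-- boundary B inside the i-th class then has B t - x ∈ {t, n + t}.
moderateColours-colouring : ∀ {n t} .{{_ : NonZero t}} → 3 ≤ n → t ≤ n → ¬ 3 ∣ t → 2 * n < 3 * t →
  HasEquitableTreeColoring (K3 n) t 3
moderateColours-colouring {n} {t} 3≤n t≤n 3∤t 2n<3t = floorColouring crossing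
  where
  δ<t : n ∸ t < t
  δ<t = m<n+o⇒m∸n<o n t (subst (n <_) (cong (t +_) (+-identityʳ t)) (2n<3t⇒n<2t {n} {t} 2n<3t))
  open K3FloorColouring n 3≤n t (n ∸ t) δ<t

  crossing : ∀ i → i < t → ∀ p → 0 < p → p < 3 → b i < p * n → p * n < b (suc i) →
    CrossesAsStar (b i) (b (suc i)) (p * n)
  crossing i _ p 0<p p<3 lo<B B<hi =
    subst (λ hi → CrossesAsStar (b i) hi B) (sym b[1+i]≡hi)
      (floor-crossesAsStar 2n<3t (subst (B <_) b[1+i]≡hi B<hi) distance)
    where
    x = 3 * n * i + (n ∸ t)
    B = p * n
    K = 1 + 3 * i
    P = p * t

    b[1+i]≡hi : b (suc i) ≡ (x + 3 * n) / t
    b[1+i]≡hi = cong (_/ t) (N[1+i]+δ≡[Ni+δ]+N i)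

    x+t≡nK : x + t ≡ n * K
    x+t≡nK = begin
      3 * n * i + (n ∸ t) + t   ≡⟨ +-assoc (3 * n * i) (n ∸ t) t ⟩
      3 * n * i + (n ∸ t + t)   ≡⟨ cong (3 * n * i +_) (m∸n+n≡m t≤n) ⟩
      3 * n * i + n             ≡⟨ regroup n i ⟩
      n * (1 + 3 * i)           ∎
      where
      open ≡-Reasoning
      regroup : ∀ n i → 3 * n * i + n ≡ n * (1 + 3 * i)
      regroup = solve-∀

    Bt≡nP : B * t ≡ n * P
    Bt≡nP = regroup p n t
      where
      regroup : ∀ p n t → p * n * t ≡ n * (p * t)
      regroup = solve-∀

    nK<nP+t : n * K < n * P + t
    nK<nP+t = subst₂ (λ l r → l < r + t) x+t≡nK Bt≡nP (+-monoˡ-< t (m/n<o⇒m<o*n lo<B))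

    nP<n[3+K] : n * P < n * (3 + K)
    nP<n[3+K] = begin-strict
      n * P               ≡⟨ Bt≡nP ⟨
      B * t               <⟨ m<m+n (B * t) (ℕ.>-nonZero⁻¹ t) ⟩
      B * t + t           ≡⟨ +-comm (B * t) t ⟩
      suc B * t           ≤⟨ m≤o/n⇒m*n≤o (subst (B <_) b[1+i]≡hi B<hi) ⟩
      x + 3 * n           ≤⟨ +-monoˡ-≤ (3 * n) (m≤m+n x t) ⟩
      x + t + 3 * n       ≡⟨ cong (_+ 3 * n) x+t≡nK ⟩
      n * K + 3 * n       ≡⟨ regroup n K ⟩
      n * (3 + K)         ∎
      where
      open ≤-Reasoning
      regroup : ∀ n K → n * K + 3 * n ≡ n * (3 + K)
      regroup = solve-∀

    P≢2+K : P ≢ 2 + K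
    P≢2+K P≡3[1+i] = 3∤t (3∣pt⇒3∣t 0<p p<3 (divides (1 + i) (trans P≡3[1+i] (regroup i))))
      where
      regroup : ∀ i → 2 + (1 + 3 * i) ≡ (1 + i) * 3
      regroup = solve-∀

    distance : x + t ≡ B * t ⊎ x + (n + t) ≡ B * t
    distance = nextBoundary (P≡K⊎P≡1+K t≤n nK<nP+t nP<n[3+K] P≢2+K)
      where
      open ≡-Reasoning
      nextBoundary : P ≡ K ⊎ P ≡ suc K → x + t ≡ B * t ⊎ x + (n + t) ≡ B * t
      nextBoundary (inj₁ P≡K) = inj₁ (begin
        x + t     ≡⟨ x+t≡nK ⟩
        n * K     ≡⟨ cong (n *_) P≡K ⟨
        n * P     ≡⟨ Bt≡nP ⟨
        B * t     ∎)
      nextBoundary (inj₂ P≡1+K) = inj₂ (begin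
        x + (n + t) ≡⟨ trans (cong (x +_) (+-comm n t)) (sym (+-assoc x t n)) ⟩
        x + t + n   ≡⟨ cong (_+ n) x+t≡nK ⟩
        n * K + n   ≡⟨ trans (+-comm (n * K) n) (sym (*-suc n K)) ⟩
        n * suc K   ≡⟨ cong (n *_) P≡1+K ⟨
        n * P       ≡⟨ Bt≡nP ⟨
        B * t       ∎)

-- No offset δ gives suitable floor breakpoints for n = 6 and t = 4.
K3-6-colouring-4 : HasEquitableTreeColoring (K3 6) 4 3
K3-6-colouring-4 = intervalColouring 4 balanced isTreeSlot
  where
  b : ℕ → ℕ
  b 0 = 0
  b 1 = 5
  b 2 = 9
  b 3 = 13
  b _ = 18

  b-mono : ∀ i → b i ≤ b (suc i)
  b-mono 0 = ≤ᵇ⇒≤ _ _ _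
  b-mono 1 = ≤ᵇ⇒≤ _ _ _
  b-mono 2 = ≤ᵇ⇒≤ _ _ _
  b-mono 3 = ≤ᵇ⇒≤ _ _ _
  b-mono (suc (suc (suc (suc _)))) = ≤-refl

  open IntervalColouring (K3 6) {4} b b-mono refl refl
  open K3Intervals 6 (≤ᵇ⇒≤ _ _ _)

  balanced : ∀ i → i < 4 → 4 ≤ b (suc i) ∸ b i × b (suc i) ∸ b i ≤ 4 + 1
  balanced 0 _ = ≤ᵇ⇒≤ _ _ _ , ≤ᵇ⇒≤ _ _ _
  balanced 1 _ = ≤ᵇ⇒≤ _ _ _ , ≤ᵇ⇒≤ _ _ _
  balanced 2 _ = ≤ᵇ⇒≤ _ _ _ , ≤ᵇ⇒≤ _ _ _
  balanced 3 _ = ≤ᵇ⇒≤ _ _ _ , ≤ᵇ⇒≤ _ _ _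
  balanced (suc (suc (suc (suc _)))) (s≤s (s≤s (s≤s (s≤s ()))))

  isTreeSlot : ∀ i → i < 4 → IsTreeClass (K3 6) 3 (Slot i)
  isTreeSlot 0 _ = inPart⇒isTreeClass {q = 0} z≤n (≤ᵇ⇒≤ _ _ _)
  isTreeSlot 1 _ = starInterval⇒isTreeClass {q = 1} {c = 5} ≤-refl (≤ᵇ⇒≤ _ _ _)
    λ j 5≤j j<9 j≢5 → ≤∧≢⇒< 5≤j (j≢5 ∘ sym) , <-trans j<9 (≤ᵇ⇒≤ _ _ _)
  isTreeSlot 2 _ = starInterval⇒isTreeClass {q = 1} {c = 12} ≤-refl (≤ᵇ⇒≤ _ _ _)
    λ j 9≤j j<13 j≢12 → ≤-trans (≤ᵇ⇒≤ _ _ _) 9≤j , ≤∧≢⇒< (s≤s⁻¹ j<13) j≢12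
  isTreeSlot 3 _ = inPart⇒isTreeClass {q = 2} (≤ᵇ⇒≤ _ _ _) ≤-refl
  isTreeSlot (suc (suc (suc (suc _)))) (s≤s (s≤s (s≤s (s≤s ()))))

1≤[n+1]/4 : ∀ {n} → 3 ≤ n → 1 ≤ (n + 1) / 4
1≤[n+1]/4 {n} 3≤n = m≥n⇒m/n>0 (subst (4 ≤_) (+-comm 1 n) (s≤s 3≤n))

exceptional⇒n≡6×t≡4 : ∀ {n t} → 3 ≤ n → 3 * ((n + 1) / 4) ≤ t → ¬ 3 ∣ t → 3 * t ≤ 2 * n → n ≡ 6 × t ≡ 4
exceptional⇒n≡6×t≡4 {n} {t} 3≤n 3m≤t 3∤t 3t≤2n = n≡6 , t≡4
  where
  m = (n + 1) / 4
  n≤4m+2 : n ≤ 4 * m + 2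
  n≤4m+2 = +-cancelʳ-≤ 2 n (4 * m + 2) (begin
    n + 2           ≡⟨ +-comm n 2 ⟩
    suc (suc n)     ≡⟨ cong suc (+-comm 1 n) ⟩
    suc (n + 1)     ≤⟨ m<[1+m/n]*n (n + 1) ⟩
    suc m * 4       ≡⟨ regroup m ⟩
    4 * m + 2 + 2   ∎)
    where
    open ≤-Reasoning
    regroup : ∀ m → suc m * 4 ≡ 4 * m + 2 + 2
    regroup = solve-∀
  3m<t : 3 * m < t
  3m<t = ≤∧≢⇒< 3m≤t λ 3m≡t → 3∤t (divides m (trans (sym 3m≡t) (*-comm 3 m)))
  m≤1 : m ≤ 1
  m≤1 = +-cancelˡ-≤ (8 * m + 3) m 1 (begin
    8 * m + 3 + m    ≡⟨ regroup₁ m ⟩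
    3 * (3 * m + 1)  ≤⟨ *-monoʳ-≤ 3 (subst (_≤ t) (+-comm 1 (3 * m)) 3m<t) ⟩
    3 * t            ≤⟨ 3t≤2n ⟩
    2 * n            ≤⟨ *-monoʳ-≤ 2 n≤4m+2 ⟩
    2 * (4 * m + 2)  ≡⟨ regroup₂ m ⟩
    8 * m + 3 + 1    ∎)
    where
    open ≤-Reasoning
    regroup₁ : ∀ m → 8 * m + 3 + m ≡ 3 * (3 * m + 1)
    regroup₁ = solve-∀
    regroup₂ : ∀ m → 2 * (4 * m + 2) ≡ 8 * m + 3 + 1
    regroup₂ = solve-∀
  m≡1 : m ≡ 1
  m≡1 = ≤-antisym m≤1 (1≤[n+1]/4 3≤n)
  4≤t : 4 ≤ t
  4≤t = subst (λ k → 3 * k < t) m≡1 3m<t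
  n≤6 : n ≤ 6
  n≤6 = subst (λ k → n ≤ 4 * k + 2) m≡1 n≤4m+2
  t≡4 : t ≡ 4
  t≡4 = ≤-antisym (*-cancelˡ-≤ 3 (≤-trans 3t≤2n (*-monoʳ-≤ 2 n≤6))) 4≤t
  n≡6 : n ≡ 6
  n≡6 = ≤-antisym n≤6 (*-cancelˡ-≤ 2 (≤-trans (*-monoʳ-≤ 3 4≤t) 3t≤2n))

bound⇒nonZero : ∀ {n t} → 3 ≤ n → 3 * ((n + 1) / 4) ≤ t → NonZero t
bound⇒nonZero 3≤n 3m≤t = ℕ.>-nonZero (≤-trans (≤-trans (1≤[n+1]/4 3≤n) (m≤n*m _ 3)) 3m≤t)

theorem5 : (n : ℕ) → 3 ≤ n → StronglyEquitable (K3 n) 3 (3 * ((n + 1) / 4))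
theorem5 n 3≤n t 3m≤t with n <? t | 3 ∣? t | 2 * n <? 3 * t
... | yes n<t | _       | _         = manyColours-colouring 3≤n n<t
... | no _    | yes 3∣t | _         =
  divisibleColours-colouring ⦃ bound⇒nonZero 3≤n 3m≤t ⦄ 3≤n 3∣t
... | no n≮t  | no 3∤t  | yes 2n<3t =
  moderateColours-colouring ⦃ bound⇒nonZero 3≤n 3m≤t ⦄ 3≤n (≮⇒≥ n≮t) 3∤t 2n<3t
... | no _    | no 3∤t  | no 2n≮3t  =
  let (n≡6 , t≡4) = exceptional⇒n≡6×t≡4 3≤n 3m≤t 3∤t (≮⇒≥ 2n≮3t) in
  subst₂ (λ n t → HasEquitableTreeColoring (K3 n) t 3) (sym n≡6) (sym t≡4) K3-6-colouring-4
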